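{- For every odd encoding $\alpha$, the subsequence encoded by $\phi(\alpha)$ is the reverse (read backwards) of the subsequence encoded by $\alpha$.
   Context: Fix $n \geq 0$. For a vector $\vec b = [b_0, \ldots, b_{2n}]$ of non-negative integers, let $W(\vec b)$ be the binary word $B_0 B_1 \cdots B_{2n}$, where $B_j = (01)^{b_j+1}$ for $j$ even and $B_j = (10)^{b_j+1}$ for $j$ odd (blocks numbered from $0$). An encoding $(\vec b; s, l; t, m)$ with $0 \le s \le t \le 2n$, $0 \leq l < 2(b_s+1)$, $0 \leq m < 2(b_t+1)$ designates the contiguous substring (subsequence) of $W(\vec b)$ starting in block $s$ immediately after its first $l$ symbols and ending in block $t$ immediately before its last $m$ symbols. An odd encoding is an encoding with $s < t$, $s$ and $t$ of different parity, and $l$ and $m$ of different parity. The map $\phi$ on odd encodings is $\phi(\vec b; s, l; t, m) = (\vec c; s, m; t, l)$, where $c_i = b_i$ for $i < s$ or $i > t$ and $c_i = b_{s+t-i}$ for $s \leq i \leq t$; the subsequence encoded by $\phi(\alpha)$ is a substring of $W(\vec c)$. -}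

module Defs where

open import Data.Nat using (ℕ; zero; suc; _+_; _*_; _∸_; _≤ᵇ_; _<_; _≤_)
open import Data.Nat.DivMod using (_%_)
open import Data.Bool using (Bool; true; false; if_then_else_; _∧_)
open import Data.List using (List; []; _∷_; _++_; drop; reverse)
open import Data.Vec using (Vec; lookup; tabulate)
open import Data.Fin using (toℕ)
open import Relation.Binary.PropositionalEquality using (_≡_; _≢_)

-- Binary symbols: false = 0, true = 1.

rep01 : ℕ → List Bool
rep01 zero    = []
rep01 (suc k) = false ∷ true ∷ rep01 k

rep10 : ℕ → List Bool
rep10 zero    = []
rep10 (suc k) = true ∷ false ∷ rep10 k

block : ℕ → ℕ → List Bool
block j bj = if j % 2 ≤ᵇ 0 then rep01 (suc bj) else rep10 (suc bj)

-- entry i of a vector, read as a natural-number index (0 if out of range)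
at : ∀ {k} → Vec ℕ k → ℕ → ℕ
at Vec.[]       _       = 0
at (x Vec.∷ xs) zero    = x
at (x Vec.∷ xs) (suc i) = at xs i

-- B_i B_{i+1} ... B_{i+k}   (k+1 consecutive blocks starting at block i)
blocksFrom : ∀ {k} → Vec ℕ k → ℕ → ℕ → List Bool
blocksFrom b i zero    = block i (at b i)
blocksFrom b i (suc k) = block i (at b i) ++ blocksFrom b (suc i) k

W : ∀ n → Vec ℕ (suc (2 * n)) → List Bool
W n b = blocksFrom b 0 (2 * n)

dropEnd : ∀ {A : Set} → ℕ → List A → List A
dropEnd m xs = reverse (drop m (reverse xs))

-- The subsequence designated by the encoding (b; s, l; t, m) (for s ≤ t):
-- the blocks B_s ... B_t, with the first l symbols of B_s and the last m
-- symbols of B_t removed.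
encoded : ∀ n → Vec ℕ (suc (2 * n)) → ℕ → ℕ → ℕ → ℕ → List Bool
encoded n b s l t m = dropEnd m (drop l (blocksFrom b s (t ∸ s)))

IsEncoding : ∀ n → Vec ℕ (suc (2 * n)) → ℕ → ℕ → ℕ → ℕ → Set
IsEncoding n b s l t m =
  (s ≤ t) × (t ≤ 2 * n) × (l < 2 * suc (at b s)) × (m < 2 * suc (at b t))
  where open import Data.Product using (_×_)

IsOddEncoding : ∀ n → Vec ℕ (suc (2 * n)) → ℕ → ℕ → ℕ → ℕ → Set
IsOddEncoding n b s l t m =
  IsEncoding n b s l t m × (s < t) × (s % 2 ≢ t % 2) × (l % 2 ≢ m % 2)
  where open import Data.Product using (_×_)

reflectVec : ∀ {k} → Vec ℕ k → ℕ → ℕ → Vec ℕ k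
reflectVec b s t = tabulate λ i →
  if (s ≤ᵇ toℕ i) ∧ (toℕ i ≤ᵇ t) then at b ((s + t) ∸ toℕ i) else lookup b i

-- φ(b; s, l; t, m) = (c; s, m; t, l); we record it as its components.
φvec : ∀ n → Vec ℕ (suc (2 * n)) → ℕ → ℕ → Vec ℕ (suc (2 * n))
φvec n b s t = reflectVec b s t

module Submission where

-- Write X = B_s ⋯ B_t for the blocks of W(b) from s to t.  The proof has two independent
-- halves.
--   * Blocks.  Since c reverses the entries b_s … b_t, the j-th block C_{s+j}
--     has the length parameter of B_{t-j}; since s and t have different
--     parity, so do s+j and t-j, hence C_{s+j} is (01)^… where B_{t-j} is
--     (10)^… and vice versa, i.e. C_{s+j} = reverse B_{t-j}.  Concatenating,
--     C_s ⋯ C_t = reverse X.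
--   * Trimming.  Trimming m at the front and l at the back of reverse X is
--     the reverse of trimming l at the front and m at the back of X; this
--     only needs that trimming the two ends of a list commutes.

open import Defs
open import Data.Nat using (ℕ; suc; _*_)
open import Data.Vec using (Vec)
open import Data.List using (reverse)
open import Relation.Binary.PropositionalEquality using (_≡_)

open import Data.Nat using (zero; _+_; _∸_; _≤_; _<_; _≤ᵇ_; s≤s)
open import Data.Nat.Properties
open import Data.Nat.DivMod using (_%_; m%n<n; %-distribˡ-+; m*n%n≡0)
open import Data.Nat.Tactic.RingSolver using (solve-∀)
open import Data.Bool using (Bool; true; false; if_then_else_; _∧_)
open import Data.Bool.Properties using (T-≡)
open import Data.List using (List; []; _∷_; _++_; drop; take; length; [_])
open import Data.List.Properties
  using (reverse-++; reverse-involutive; length-reverse; take-all; take-[]; ++-assoc; length-drop)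
open import Data.Vec using (tabulate; lookup)
open import Data.Fin using (Fin; toℕ; fromℕ<)
open import Data.Fin.Properties using (toℕ-fromℕ<)
open import Data.Product using (_,_)
open import Data.Empty using (⊥-elim)
open import Function using (_∘_; Equivalence)
open import Relation.Nullary using (¬_)
open import Relation.Binary.PropositionalEquality using (refl; sym; trans; cong; cong₂; subst; module ≡-Reasoning)

take-++-within : ∀ {A : Set} k (xs ys : List A) → k ≤ length xs → take k (xs ++ ys) ≡ take k xs
take-++-within zero    xs       ys _       = refl
take-++-within (suc k) (x ∷ xs) ys (s≤s p) = cong (x ∷_) (take-++-within k xs ys p)

reverse-drop : ∀ {A : Set} l (R : List A) → reverse (drop l R) ≡ take (length R ∸ l) (reverse R)
reverse-drop zero    R       = sym (take-all (length R) (reverse R) (≤-reflexive (length-reverse R)))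
reverse-drop (suc l) []      = refl
reverse-drop (suc l) (r ∷ R) = begin
  reverse (drop l R)                              ≡⟨ reverse-drop l R ⟩
  take (length R ∸ l) (reverse R)                 ≡⟨ take-++-within (length R ∸ l) (reverse R) [ r ] fits ⟨
  take (length R ∸ l) (reverse R ++ [ r ])        ≡⟨ cong (take (length R ∸ l)) (reverse-++ [ r ] R) ⟨
  take (length R ∸ l) (reverse (r ∷ R))           ∎
  where
  open ≡-Reasoning
  fits : length R ∸ l ≤ length (reverse R)
  fits = ≤-trans (m∸n≤m (length R) l) (≤-reflexive (sym (length-reverse R)))

dropEnd≡take : ∀ {A : Set} l (Y : List A) → dropEnd l Y ≡ take (length Y ∸ l) Y
dropEnd≡take l Y = trans (reverse-drop l (reverse Y))
  (cong₂ (λ len ys → take (len ∸ l) ys) (length-reverse Y) (reverse-involutive Y))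

drop-take : ∀ {A : Set} m k (Y : List A) → drop m (take k Y) ≡ take (k ∸ m) (drop m Y)
drop-take zero    k       Y        = refl
drop-take (suc m) zero    Y        = refl
drop-take (suc m) (suc k) []       = sym (take-[] (k ∸ m))
drop-take (suc m) (suc k) (y ∷ ys) = drop-take m k ys

dropEnd-drop-comm : ∀ {A : Set} l m (Y : List A) → dropEnd l (drop m Y) ≡ drop m (dropEnd l Y)
dropEnd-drop-comm l m Y = begin
  dropEnd l (drop m Y)                  ≡⟨ dropEnd≡take l (drop m Y) ⟩
  take (length (drop m Y) ∸ l) (drop m Y) ≡⟨ cong (λ len → take (len ∸ l) (drop m Y)) (length-drop m Y) ⟩
  take (length Y ∸ m ∸ l) (drop m Y)    ≡⟨ cong (λ len → take len (drop m Y)) swap ⟩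
  take (length Y ∸ l ∸ m) (drop m Y)    ≡⟨ drop-take m (length Y ∸ l) Y ⟨
  drop m (take (length Y ∸ l) Y)        ≡⟨ cong (drop m) (dropEnd≡take l Y) ⟨
  drop m (dropEnd l Y)                  ∎
  where
  open ≡-Reasoning
  swap : length Y ∸ m ∸ l ≡ length Y ∸ l ∸ m
  swap = trans (∸-+-assoc (length Y) m l)
    (trans (cong (length Y ∸_) (+-comm m l)) (sym (∸-+-assoc (length Y) l m)))

trim-reverse : ∀ {A : Set} l m (X : List A) →
  dropEnd l (drop m (reverse X)) ≡ reverse (dropEnd m (drop l X))
trim-reverse l m X = begin
  dropEnd l (drop m (reverse X))           ≡⟨ dropEnd-drop-comm l m (reverse X) ⟩
  drop m (dropEnd l (reverse X))           ≡⟨ cong (drop m ∘ reverse ∘ drop l) (reverse-involutive X) ⟩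
  drop m (reverse (drop l X))              ≡⟨ reverse-involutive _ ⟨
  reverse (dropEnd m (drop l X))           ∎
  where open ≡-Reasoning

sameParity⇒evenSum : ∀ x y → x % 2 ≡ y % 2 → (x + y) % 2 ≡ 0
sameParity⇒evenSum x y same = begin
  (x + y) % 2             ≡⟨ %-distribˡ-+ x y 2 ⟩
  (x % 2 + y % 2) % 2     ≡⟨ cong (λ r → (r + y % 2) % 2) same ⟩
  (y % 2 + y % 2) % 2     ≡⟨ cong (_% 2) (double (y % 2)) ⟩
  (y % 2 * 2) % 2         ≡⟨ m*n%n≡0 (y % 2) 2 ⟩
  0                       ∎
  where
  open ≡-Reasoning
  double : ∀ r → r + r ≡ r * 2
  double = solve-∀

evenSum⇒sameParity : ∀ x y → (x + y) % 2 ≡ 0 → x % 2 ≡ y % 2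
evenSum⇒sameParity x y even
  with x % 2 | y % 2 | m%n<n x 2 | m%n<n y 2 | %-distribˡ-+ x y 2
... | 0 | 0 | _ | _ | _   = refl
... | 1 | 1 | _ | _ | _   = refl
... | 0 | 1 | _ | _ | odd = ⊥-elim (1+n≢0 (trans (sym odd) even))
... | 1 | 0 | _ | _ | odd = ⊥-elim (1+n≢0 (trans (sym odd) even))
... | suc (suc _) | _ | s≤s (s≤s ()) | _ | _
... | _ | suc (suc _) | _ | s≤s (s≤s ()) | _

parity-transfer : ∀ s t x y → ¬ (s % 2 ≡ t % 2) → x + y ≡ s + t → ¬ (x % 2 ≡ y % 2)
parity-transfer s t x y s≢t sum same =
  s≢t (evenSum⇒sameParity s t (trans (cong (_% 2) (sym sum)) (sameParity⇒evenSum x y same)))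

snoc-rep10 : ∀ k → rep10 k ++ (true ∷ false ∷ []) ≡ true ∷ false ∷ rep10 k
snoc-rep10 zero    = refl
snoc-rep10 (suc k) = cong (λ w → true ∷ false ∷ w) (snoc-rep10 k)

reverse-rep01 : ∀ k → reverse (rep01 k) ≡ rep10 k
reverse-rep01 zero    = refl
reverse-rep01 (suc k) = begin
  reverse (false ∷ true ∷ rep01 k)               ≡⟨ reverse-++ (false ∷ true ∷ []) (rep01 k) ⟩
  reverse (rep01 k) ++ (true ∷ false ∷ [])        ≡⟨ cong (_++ (true ∷ false ∷ [])) (reverse-rep01 k) ⟩
  rep10 k ++ (true ∷ false ∷ [])                  ≡⟨ snoc-rep10 k ⟩
  true ∷ false ∷ rep10 k                          ∎
  where open ≡-Reasoning

reverse-rep10 : ∀ k → reverse (rep10 k) ≡ rep01 k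
reverse-rep10 k = trans (cong reverse (sym (reverse-rep01 k))) (reverse-involutive (rep01 k))

block-reverse : ∀ i e x → ¬ (i % 2 ≡ e % 2) → block i x ≡ reverse (block e x)
block-reverse i e x i≢e with i % 2 | e % 2 | m%n<n i 2 | m%n<n e 2
... | 0 | 0 | _ | _ = ⊥-elim (i≢e refl)
... | 1 | 1 | _ | _ = ⊥-elim (i≢e refl)
... | 0 | 1 | _ | _ = sym (reverse-rep10 (suc x))
... | 1 | 0 | _ | _ = sym (reverse-rep01 (suc x))
... | suc (suc _) | _ | s≤s (s≤s ()) | _
... | _ | suc (suc _) | _ | s≤s (s≤s ())

blockAt : ∀ {k} → Vec ℕ k → ℕ → List Bool
blockAt b i = block i (at b i)

blocksFrom-snoc : ∀ {k} (b : Vec ℕ k) d e →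
  blocksFrom b e (suc d) ≡ blocksFrom b e d ++ blockAt b (suc d + e)
blocksFrom-snoc b zero    e = refl
blocksFrom-snoc b (suc d) e = begin
  blockAt b e ++ blocksFrom b (suc e) (suc d)
    ≡⟨ cong (blockAt b e ++_) (blocksFrom-snoc b d (suc e)) ⟩
  blockAt b e ++ (blocksFrom b (suc e) d ++ blockAt b (suc d + suc e))
    ≡⟨ ++-assoc (blockAt b e) (blocksFrom b (suc e) d) _ ⟨
  blocksFrom b e (suc d) ++ blockAt b (suc d + suc e)
    ≡⟨ cong (λ p → blocksFrom b e (suc d) ++ blockAt b p) (+-suc (suc d) e) ⟩
  blocksFrom b e (suc d) ++ blockAt b (suc (suc d) + e)
    ∎
  where open ≡-Reasoning

blocksFrom-mirror : ∀ {k k′} (c : Vec ℕ k) (b : Vec ℕ k′) d i e →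
  (∀ j k → j + k ≡ d → blockAt c (j + i) ≡ reverse (blockAt b (k + e))) →
  blocksFrom c i d ≡ reverse (blocksFrom b e d)
blocksFrom-mirror c b zero    i e mirror = mirror 0 0 refl
blocksFrom-mirror c b (suc d) i e mirror = begin
  blockAt c i ++ blocksFrom c (suc i) d
    ≡⟨ cong₂ _++_ (mirror 0 (suc d) refl) (blocksFrom-mirror c b d (suc i) e shifted) ⟩
  reverse (blockAt b (suc d + e)) ++ reverse (blocksFrom b e d)
    ≡⟨ reverse-++ (blocksFrom b e d) (blockAt b (suc d + e)) ⟨
  reverse (blocksFrom b e d ++ blockAt b (suc d + e))
    ≡⟨ cong reverse (blocksFrom-snoc b d e) ⟨
  reverse (blocksFrom b e (suc d))
    ∎
  where
  open ≡-Reasoning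
  shifted : ∀ j k → j + k ≡ d → blockAt c (j + suc i) ≡ reverse (blockAt b (k + e))
  shifted j k j+k≡d = subst (λ p → blockAt c p ≡ reverse (blockAt b (k + e)))
    (sym (+-suc j i)) (mirror (suc j) k (cong suc j+k≡d))

at-tabulate : ∀ {k} (f : Fin k → ℕ) i (i<k : i < k) → at (tabulate f) i ≡ f (fromℕ< i<k)
at-tabulate {suc k} f zero    _         = refl
at-tabulate {suc k} f (suc i) (s≤s i<k) = at-tabulate (f ∘ Fin.suc) i i<k
  where import Data.Fin as Fin

at-reflectVec : ∀ {k} (b : Vec ℕ k) s t i → s ≤ i → i ≤ t → i < k →
  at (reflectVec b s t) i ≡ at b ((s + t) ∸ i)
at-reflectVec b s t i s≤i i≤t i<k = trans (at-tabulate _ i i<k) (inside (fromℕ< i<k) (toℕ-fromℕ< i<k))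
  where
  inside : ∀ x → toℕ x ≡ i →
    (if (s ≤ᵇ toℕ x) ∧ (toℕ x ≤ᵇ t) then at b ((s + t) ∸ toℕ x) else lookup b x) ≡ at b ((s + t) ∸ i)
  inside x refl rewrite Equivalence.to T-≡ (≤⇒≤ᵇ s≤i) | Equivalence.to T-≡ (≤⇒≤ᵇ i≤t) = refl

reflected-blocks : ∀ n (b : Vec ℕ (suc (2 * n))) s t → s ≤ t → t ≤ 2 * n →
  ¬ (s % 2 ≡ t % 2) →
  ∀ j k → j + k ≡ t ∸ s → blockAt (φvec n b s t) (j + s) ≡ reverse (blockAt b (k + s))
reflected-blocks n b s t s≤t t≤2n s≢t j k j+k≡t∸s = begin
  block (j + s) (at (reflectVec b s t) (j + s))    ≡⟨ cong (block (j + s)) entry ⟩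
  block (j + s) (at b (k + s))                     ≡⟨ block-reverse (j + s) (k + s) _ parity ⟩
  reverse (block (k + s) (at b (k + s)))           ∎
  where
  open ≡-Reasoning
  t≡ : (j + k) + s ≡ t
  t≡ = trans (cong (_+ s) j+k≡t∸s) (m∸n+n≡m s≤t)
  split : s + t ≡ (j + s) + (k + s)
  split = trans (cong (s +_) (sym t≡)) (rearrange s j k)
    where
    rearrange : ∀ s j k → s + ((j + k) + s) ≡ (j + s) + (k + s)
    rearrange = solve-∀
  j+s≤t : j + s ≤ t
  j+s≤t = subst (j + s ≤_) t≡ (+-monoˡ-≤ s (m≤m+n j k))
  entry : at (reflectVec b s t) (j + s) ≡ at b (k + s)
  entry = trans (at-reflectVec b s t (j + s) (m≤n+m s j) j+s≤t (s≤s (≤-trans j+s≤t t≤2n)))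
    (cong (at b) (trans (cong (_∸ (j + s)) split) (m+n∸m≡n (j + s) (k + s))))
  parity : ¬ ((j + s) % 2 ≡ (k + s) % 2)
  parity = parity-transfer s t (j + s) (k + s) s≢t (sym split)

mainTheorem8 : ∀ (n : ℕ) (b : Vec ℕ (suc (2 * n))) (s l t m : ℕ) →
    IsOddEncoding n b s l t m →
    encoded n (φvec n b s t) s m t l ≡ reverse (encoded n b s l t m)
mainTheorem8 n b s l t m ((s≤t , t≤2n , _ , _) , _ , s≢t , _) = begin
  dropEnd l (drop m (blocksFrom (φvec n b s t) s (t ∸ s)))  ≡⟨ cong (dropEnd l ∘ drop m) blocks ⟩
  dropEnd l (drop m (reverse (blocksFrom b s (t ∸ s))))     ≡⟨ trim-reverse l m (blocksFrom b s (t ∸ s)) ⟩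
  reverse (dropEnd m (drop l (blocksFrom b s (t ∸ s))))     ∎
  where
  open ≡-Reasoning
  blocks : blocksFrom (φvec n b s t) s (t ∸ s) ≡ reverse (blocksFrom b s (t ∸ s))
  blocks = blocksFrom-mirror (φvec n b s t) b (t ∸ s) s s
    (reflected-blocks n b s t s≤t t≤2n s≢t)
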